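{- Fix block sizes $r_0,\ldots,r_n$ and a lacing diagram $\mathbf w=(w_1,\ldots,w_n)$, where $w_j$ is an $r_{j-1}\times r_j$ partial permutation. Then the Demazure product $\delta(P(P_1,\ldots,P_n))$ is the same for all choices of $r_{j-1}\times r_j$ pipe dreams $P_1,\ldots,P_n$ satisfying $\check P_j\in\mathcal P(w_j)$ for all $j=1,\ldots,n$.
   Context: A $k\times\ell$ partial permutation is a $0/1$ matrix with at most one $1$ per row and column; $\tilde w\in S_\infty$ is its unique minimal-length completion to a permutation matrix with $w$ as upper-left corner. A pipe dream is a finite set of boxes (crosses) in a grid; its word lists $s_{i+j-1}$ for each cross in row $i$, column $j$, reading each row right to left, rows top to bottom; its Demazure product $\delta(P)$ is the product of the word using $s_i^2=s_i$ and the braid relations. $\mathcal P(w)=\{P:\delta(P)=\tilde w\}$, and $\check P$ is the pipe dream $P$ (of its given rectangular size) rotated by $180^\circ$. With $d=\sum r_j$, divide the $d\times d$ grid into blocks: block row $j$ ($j=0,\ldots,n$ from the top) has height $r_j$, block column $i$ (counted from the right) has width $r_i$, $B_{ji}$ the block in block row $j$, block column $i$. For $r_{j-1}\times r_j$ pipe dreams $P_j$, $P(P_1,\ldots,P_n)$ is the $d\times d$ pipe dream whose crosses are all boxes of the blocks $B_{ji}$ with $i\ge j+2$ (strictly above the block superantidiagonal), together with $P_j$ placed in the superantidiagonal block $B_{j-1,j}$ for each $j$, and no others. -}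

module Defs where

open import Data.Nat using (ℕ; zero; suc; _+_; _∸_; _<_; _≤_; _<ᵇ_; _≡ᵇ_)
open import Data.Bool using (Bool; true; false; if_then_else_; _∧_; not)
open import Data.Fin using (Fin; toℕ; inject₁) renaming (zero to fzero; suc to fsuc)
open import Data.List using (List; []; _∷_; _++_; foldl)
open import Data.Maybe using (Maybe; just; nothing)
open import Data.Product using (_×_; _,_)
open import Relation.Binary.PropositionalEquality using (_≡_)

-- Permutations of S_∞ in one-line notation, as functions ℕ → ℕ on the
-- positions 1,2,3,… (position 0 is unused and always fixed).
-- s i (i ≥ 1) is the simple transposition exchanging i and i+1.

s : ℕ → ℕ → ℕ
s i k = if k ≡ᵇ i then suc i else (if k ≡ᵇ suc i then i else k)

-- Demazure (0-Hecke) product: u * s_i = u s_i if ℓ(u s_i) > ℓ(u)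
-- (i.e. u(i) < u(i+1)), and u otherwise.  This is the product computed
-- with s_i² = s_i and the braid relations.
demStep : (ℕ → ℕ) → ℕ → (ℕ → ℕ)
demStep u i = if u i <ᵇ u (suc i) then (λ k → u (s i k)) else u

demazure : List ℕ → (ℕ → ℕ)
demazure = foldl demStep (λ k → k)

-- Pipe dreams of rectangular size m × n: boxes (i , j), 0 ≤ i < m,
-- 0 ≤ j < n (0-indexed, row i from the top, column j from the left);
-- a box is a cross iff the predicate is true.  Entries outside the
-- rectangle are never read.

PipeDream : Set
PipeDream = ℕ → ℕ → Bool

downFrom : ℕ → List ℕ
downFrom zero = []
downFrom (suc n) = n ∷ downFrom n

upTo : ℕ → List ℕ
upTo zero = []
upTo (suc n) = upTo n ++ (n ∷ [])

-- Word of row i (0-indexed), read right to left; a cross at 1-indexed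
-- (i+1 , j+1) contributes s_{(i+1)+(j+1)-1} = s_{i+j+1}.
rowWord : PipeDream → ℕ → List ℕ → List ℕ
rowWord P i [] = []
rowWord P i (j ∷ js) = (if P i j then (suc (i + j) ∷ []) else []) ++ rowWord P i js

pdWordRows : PipeDream → ℕ → List ℕ → List ℕ
pdWordRows P n [] = []
pdWordRows P n (i ∷ is) = rowWord P i (downFrom n) ++ pdWordRows P n is

pdWord : (m n : ℕ) → PipeDream → List ℕ
pdWord m n P = pdWordRows P n (upTo m)

δ : (m n : ℕ) → PipeDream → (ℕ → ℕ)
δ m n P = demazure (pdWord m n P)

rot : (m n : ℕ) → PipeDream → PipeDream
rot m n P i j = P (m ∸ 1 ∸ i) (n ∸ 1 ∸ j)

record PartialPerm (k ℓ : ℕ) : Set where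
  field
    entry   : ℕ → ℕ → Bool
    rowOne  : ∀ i j j′ → i < k → j < ℓ → j′ < ℓ →
              entry i j ≡ true → entry i j′ ≡ true → j ≡ j′
    colOne  : ∀ i i′ j → i < k → i′ < k → j < ℓ →
              entry i j ≡ true → entry i′ j ≡ true → i ≡ i′
open PartialPerm public

search : (ℕ → Bool) → ℕ → ℕ → Maybe ℕ
search f from zero = nothing
search f from (suc len) = if f from then just from else search f (suc from) len

isNothing : Maybe ℕ → Bool
isNothing nothing = true
isNothing (just _) = false

count : (ℕ → Bool) → ℕ → ℕ
count f zero = 0
count f (suc m) = (if f m then 1 else 0) + count f m

module _ {k ℓ : ℕ} (w : PartialPerm k ℓ) where
  colOf : ℕ → Maybe ℕ
  colOf a = search (entry w a) 0 ℓ

  emptyRow : ℕ → Bool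
  emptyRow a = isNothing (colOf a)

  emptyCol : ℕ → Bool
  emptyCol c = isNothing (search (λ a → entry w a c) 0 k)

  nthEmptyCol : ℕ → Maybe ℕ
  nthEmptyCol m = search (λ c → emptyCol c ∧ (count emptyCol c ≡ᵇ m)) 0 ℓ

  -- The minimal-length completion w̃ ∈ S_∞ (one-line notation, positions
  -- 1,2,…): rows of w containing a 1 keep it; the empty rows, top to
  -- bottom, get 1's in columns ℓ+1, ℓ+2, …; the empty columns, left to
  -- right, get 1's in rows k+1, k+2, …; all further positions are fixed.
  completion : ℕ → ℕ
  completion zero = zero
  completion (suc a) with a <ᵇ k
  ... | true with colOf a
  ...   | just c  = suc c
  ...   | nothing = suc (ℓ + count emptyRow a)
  completion (suc a) | false with nthEmptyCol (a ∸ k)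
  ...   | just c  = suc c
  ...   | nothing = suc a

InPD : {k ℓ : ℕ} → PartialPerm k ℓ → PipeDream → Set
InPD {k} {ℓ} w P = ∀ p → δ k ℓ P p ≡ completion w p

sumSizes : (n : ℕ) → (Fin (suc n) → ℕ) → ℕ
sumSizes zero r = r fzero
sumSizes (suc n) r = r fzero + sumSizes n (λ i → r (fsuc i))

locate : (n : ℕ) → (Fin (suc n) → ℕ) → ℕ → Fin (suc n) × ℕ
locate zero r a = fzero , a
locate (suc n) r a with a <ᵇ r fzero
... | true  = fzero , a
... | false with locate n (λ i → r (fsuc i)) (a ∸ r fzero)
...   | (i , o) = fsuc i , o

-- Block row j (from the top) has
-- height r_j, block column i (from the right) has width r_i.  Pieces:
-- Ps j′ is P_{j} for j = toℕ j′ + 1, an r_{j-1} × r_j pipe dream.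
bigCross : (n : ℕ) (r : Fin (suc n) → ℕ) → (Fin n → PipeDream) →
           Fin (suc n) → ℕ → Fin (suc n) → ℕ → Bool
bigCross n r Ps j ro i co with suc (suc (toℕ j)) Data.Nat.≤ᵇ toℕ i
... | true = true
bigCross n r Ps j ro fzero co | false = false
bigCross n r Ps j ro (fsuc i′) co | false =
  if toℕ i′ ≡ᵇ toℕ j then Ps i′ ro co else false

bigPD : (n : ℕ) (r : Fin (suc n) → ℕ) → (Fin n → PipeDream) → PipeDream
bigPD n r Ps a c with locate n r a | locate n r (sumSizes n r ∸ 1 ∸ c)
... | (j , ro) | (i , coR) = bigCross n r Ps j ro i (r i ∸ 1 ∸ coR)

{-# OPTIONS --safe #-}
module Submission where

-- A pipe dream enters only through the Demazure product of its word, and words with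
-- equal Demazure products can be substituted for each other inside a longer word: on
-- the right this is immediate, on the left it is associativity of the 0-Hecke monoid,
-- which we obtain by carrying w⁻¹ along with w. Read row by row, block row 0 of
-- P(P₁, …, Pₙ) gives, for each row a, the row-a word of P₁ shifted by X = r₂ + ⋯ + rₙ
-- followed by a row of crosses whose letters lie at least two below the letters of
-- all later shifted rows of P₁. By far commutations the word becomes
-- (word P₁ shifted by X) · (rows of crosses) · (word of P(P₂, …, Pₙ) shifted by r₀).
-- Shifting letters preserves Demazure equivalence, and δ(P̌ⱼ) determines δ(Pⱼ): the
-- word of P̌ⱼ is the reversed word of Pⱼ with every letter k replaced by
-- r_{j-1} + r_j − k, which inverts the Demazure product and conjugates it by the
-- longest element.

open import Defs
open import Data.Bool using (Bool; true; false; T; if_then_else_)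
open import Data.Empty using (⊥-elim)
open import Data.Fin using (Fin; toℕ; inject₁) renaming (zero to fzero; suc to fsuc)
open import Data.List using (List; []; _∷_; _++_; [_]; foldl; foldr; map; reverse; concat; concatMap)
open import Data.List.Properties
  using (++-assoc; ++-identityʳ; map-++; map-∘; map-cong-local; foldl-++; foldr-++; reverse-++; unfold-reverse;
         reverse-involutive; reverse-map; reverse-foldl; concatMap-++; concatMap-map; map-concatMap; concatMap-cong;
         concatMap-pure)
open import Data.List.Relation.Unary.All as All using (All; []; _∷_)
open import Data.List.Relation.Unary.All.Properties using (++⁺; concat⁺; map⁺)
open import Data.Nat using (ℕ; zero; suc; _+_; _∸_; _<_; _≤_; _<ᵇ_; _≡ᵇ_; _≤ᵇ_; s≤s; z<s; s<s)
open import Data.Nat.Properties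
open import Data.Nat.Tactic.RingSolver using (solve-∀)
open import Data.Product using (_×_; _,_; proj₁; proj₂; map₁; swap)
open import Function using (_∘′_; flip)
open import Relation.Binary.Bundles using (Setoid)
open import Relation.Binary.PropositionalEquality hiding ([_])
import Relation.Binary.Reasoning.Setoid as SetoidReasoning
open import Relation.Nullary using (¬_; yes; no)
open import Relation.Nullary.Decidable using (_×-dec_)

private
  variable
    a b c d i j k t x y : ℕ
    u u′ v v′ ys zs : List ℕ

<⇒<ᵇ≡true : a < b → (a <ᵇ b) ≡ true
<⇒<ᵇ≡true {a} {b} a<b with a <ᵇ b | <⇒<ᵇ a<b
... | true | _ = refl

≮⇒<ᵇ≡false : ¬ a < b → (a <ᵇ b) ≡ false
≮⇒<ᵇ≡false {a} {b} a≮b with a <ᵇ b in eq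
... | false = refl
... | true  = ⊥-elim (a≮b (<ᵇ⇒< a b (subst T (sym eq) _)))

<ᵇ-cong : (a < b → c < d) → (c < d → a < b) → (a <ᵇ b) ≡ (c <ᵇ d)
<ᵇ-cong {a} {b} to from with a <ᵇ b in eq
... | true  = sym (<⇒<ᵇ≡true (to (<ᵇ⇒< a b (subst T (sym eq) _))))
... | false = sym (≮⇒<ᵇ≡false (λ c<d → subst T eq (<⇒<ᵇ (from c<d))))

≡ᵇ-refl : ∀ x → (x ≡ᵇ x) ≡ true
≡ᵇ-refl zero    = refl
≡ᵇ-refl (suc x) = ≡ᵇ-refl x

≢⇒≡ᵇ≡false : x ≢ y → (x ≡ᵇ y) ≡ false
≢⇒≡ᵇ≡false {x} {y} x≢y with x ≡ᵇ y in eq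
... | false = refl
... | true  = ⊥-elim (x≢y (≡ᵇ⇒≡ x y (subst T (sym eq) _)))

n<ᵇ1+n : ∀ n → (n <ᵇ suc n) ≡ true
n<ᵇ1+n n = <⇒<ᵇ≡true (n<1+n n)

1+n<ᵇn : ∀ n → (suc n <ᵇ n) ≡ false
1+n<ᵇn n = ≮⇒<ᵇ≡false (λ lt → <-asym lt (n<1+n n))

s-i≡1+i : ∀ i → s i i ≡ suc i
s-i≡1+i i rewrite ≡ᵇ-refl i = refl

s-1+i≡i : ∀ i → s i (suc i) ≡ i
s-1+i≡i i rewrite ≢⇒≡ᵇ≡false (1+n≢n {i}) | ≡ᵇ-refl i = refl

s-fix : x ≢ i → x ≢ suc i → s i x ≡ x
s-fix x≢i x≢1+i rewrite ≢⇒≡ᵇ≡false x≢i | ≢⇒≡ᵇ≡false x≢1+i = refl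

s-fix-below : x < i → s i x ≡ x
s-fix-below x<i = s-fix (<⇒≢ x<i) (<⇒≢ (m<n⇒m<1+n x<i))

s-fix-above : suc i < x → s i x ≡ x
s-fix-above 1+i<x = s-fix (>⇒≢ (<-trans (n<1+n _) 1+i<x)) (>⇒≢ 1+i<x)

s-involutive : ∀ i x → s i (s i x) ≡ x
s-involutive i x with x ≟ i
... | yes refl rewrite s-i≡1+i x = s-1+i≡i x
... | no x≢i with x ≟ suc i
...   | yes refl rewrite s-1+i≡i i = s-i≡1+i i
...   | no x≢1+i rewrite s-fix x≢i x≢1+i = s-fix x≢i x≢1+i

s-injective : s i x ≡ s i y → x ≡ y
s-injective {i} {x} {y} eq = trans (sym (s-involutive i x)) (trans (cong (s i) eq) (s-involutive i y))

s-comm : suc i < j → ∀ x → s i (s j x) ≡ s j (s i x)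
s-comm {i} {j} 1+i<j x with x ≟ i
... | yes refl rewrite s-fix-below (<-trans (n<1+n x) 1+i<j) | s-i≡1+i x | s-fix-below 1+i<j = refl
... | no x≢i with x ≟ suc i
...   | yes refl rewrite s-fix-below 1+i<j | s-1+i≡i i | s-fix-below (<-trans (n<1+n i) 1+i<j) = refl
...   | no x≢1+i rewrite s-fix x≢i x≢1+i with x ≟ j
...     | yes refl rewrite s-i≡1+i x | s-fix-above (m<n⇒m<1+n 1+i<j) = refl
...     | no x≢j with x ≟ suc j
...       | yes refl rewrite s-1+i≡i j | s-fix-above 1+i<j = refl
...       | no x≢1+j rewrite s-fix x≢j x≢1+j | s-fix x≢i x≢1+i = refl

s-suc : ∀ i x → s (suc i) (suc x) ≡ suc (s i x)
s-suc i x with x ≡ᵇ i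
... | true = refl
... | false with x ≡ᵇ suc i
...   | true  = refl
...   | false = refl

s-+ : ∀ n k y → s (n + k) (n + y) ≡ n + s k y
s-+ zero    k y = refl
s-+ (suc n) k y = trans (s-suc (n + k) (n + y)) (cong suc (s-+ n k y))

s-monotone : ¬ (a ≡ i × b ≡ suc i) → a < b → s i a < s i b
s-monotone {a} {i} {b} ¬ab a<b with a ≟ i
... | yes refl with b ≟ suc a
...   | yes b≡1+a = ⊥-elim (¬ab (refl , b≡1+a))
...   | no b≢1+a rewrite s-i≡1+i a | s-fix (>⇒≢ a<b) b≢1+a = ≤∧≢⇒< a<b (b≢1+a ∘′ sym)
s-monotone {a} {i} {b} ¬ab a<b | no a≢i with a ≟ suc i
... | yes refl rewrite s-1+i≡i i | s-fix-above a<b = <-trans (n<1+n i) a<b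
... | no a≢1+i rewrite s-fix a≢i a≢1+i with b ≟ i
...   | yes refl rewrite s-i≡1+i b = m<n⇒m<1+n a<b
...   | no b≢i with b ≟ suc i
...     | yes refl rewrite s-1+i≡i i = ≤∧≢⇒< (≤-pred a<b) a≢i
...     | no b≢1+i rewrite s-fix b≢i b≢1+i = a<b

s-<ᵇ : ¬ (a ≡ i × b ≡ suc i) → ¬ (a ≡ suc i × b ≡ i) → (s i a <ᵇ s i b) ≡ (a <ᵇ b)
s-<ᵇ {a} {i} {b} ¬ab ¬ba = <ᵇ-cong from (s-monotone ¬ab)
  where
  ¬sab : ¬ (s i a ≡ i × s i b ≡ suc i)
  ¬sab (sa≡i , sb≡1+i) =
    ¬ba (s-injective (trans sa≡i (sym (s-1+i≡i i))) , s-injective (trans sb≡1+i (sym (s-i≡1+i i))))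
  from : s i a < s i b → a < b
  from lt = subst₂ _<_ (s-involutive i a) (s-involutive i b) (s-monotone ¬sab lt)

-- Demazure products of words

Fun : Set
Fun = ℕ → ℕ

demazureFrom : Fun → List ℕ → Fun
demazureFrom = foldl demStep

demStep-cong : ∀ {f g} → f ≗ g → ∀ k → demStep f k ≗ demStep g k
demStep-cong {f} {g} f≗g k x rewrite f≗g k | f≗g (suc k) with g k <ᵇ g (suc k)
... | true  = f≗g (s k x)
... | false = f≗g x

demazureFrom-cong : ∀ {f g} → f ≗ g → ∀ u → demazureFrom f u ≗ demazureFrom g u
demazureFrom-cong f≗g []      = f≗g
demazureFrom-cong f≗g (k ∷ u) = demazureFrom-cong (demStep-cong f≗g k) u

demazureFrom-++ : ∀ f u v x → demazureFrom f (u ++ v) x ≡ demazureFrom (demazureFrom f u) v x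
demazureFrom-++ f u v x = cong (λ g → g x) (foldl-++ demStep f u v)

demStep-comm : suc i < j → ∀ f → demStep (demStep f i) j ≗ demStep (demStep f j) i
demStep-comm {i} {j} 1+i<j f x
  with f i <ᵇ f (suc i) in eqᵢ | f j <ᵇ f (suc j) in eqⱼ
... | true  | true
  rewrite s-fix-above 1+i<j | s-fix-above (m<n⇒m<1+n 1+i<j)
        | s-fix-below (<-trans (n<1+n i) 1+i<j) | s-fix-below 1+i<j | eqᵢ | eqⱼ
  = cong f (s-comm 1+i<j x)
... | true  | false
  rewrite s-fix-above 1+i<j | s-fix-above (m<n⇒m<1+n 1+i<j) | eqᵢ | eqⱼ = refl
... | false | true
  rewrite s-fix-below (<-trans (n<1+n i) 1+i<j) | s-fix-below 1+i<j | eqᵢ | eqⱼ = refl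
... | false | false rewrite eqᵢ | eqⱼ = refl

infix 4 _≅_

record _≅_ (u v : List ℕ) : Set where
  constructor mk≅
  field
    ≅⇒≗ : ∀ f → demazureFrom f u ≗ demazureFrom f v
open _≅_

≅-setoid : Setoid _ _
≅-setoid = record
  { Carrier       = List ℕ
  ; _≈_           = _≅_
  ; isEquivalence = record
    { refl  = mk≅ λ f x → refl
    ; sym   = λ u≅v → mk≅ λ f x → sym (≅⇒≗ u≅v f x)
    ; trans = λ u≅v v≅w → mk≅ λ f x → trans (≅⇒≗ u≅v f x) (≅⇒≗ v≅w f x)
    }
  }

open Setoid ≅-setoid using () renaming (refl to ≅-refl)

≅-++ : u ≅ u′ → v ≅ v′ → u ++ v ≅ u′ ++ v′
≅-++ {u} {u′} {v} {v′} u≅u′ v≅v′ = mk≅ λ f x → begin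
  demazureFrom f (u ++ v) x              ≡⟨ demazureFrom-++ f u v x ⟩
  demazureFrom (demazureFrom f u) v x    ≡⟨ demazureFrom-cong (≅⇒≗ u≅u′ f) v x ⟩
  demazureFrom (demazureFrom f u′) v x   ≡⟨ ≅⇒≗ v≅v′ _ x ⟩
  demazureFrom (demazureFrom f u′) v′ x  ≡⟨ demazureFrom-++ f u′ v′ x ⟨
  demazureFrom f (u′ ++ v′) x            ∎
  where open ≡-Reasoning

∷-commute-far : All (suc k <_) zs → k ∷ zs ≅ zs ++ [ k ]
∷-commute-far []                = ≅-refl
∷-commute-far {zs = z ∷ zs} (k+1<z ∷ k+1<zs) = mk≅ λ f x →
  trans (demazureFrom-cong (demStep-comm k+1<z f) zs x) (≅⇒≗ (∷-commute-far k+1<zs) (demStep f z) x)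

++-commute-far : All (_< t) ys → All (t <_) zs → ys ++ zs ≅ zs ++ ys
++-commute-far {zs = zs} [] _ rewrite ++-identityʳ zs = ≅-refl
++-commute-far {t} {y ∷ ys} {zs} (y<t ∷ ys<t) t<zs = begin
  y ∷ ys ++ zs         ≈⟨ ≅-++ (≅-refl {[ y ]}) (++-commute-far ys<t t<zs) ⟩
  y ∷ zs ++ ys         ≈⟨ ≅-++ (∷-commute-far (All.map (<-≤-trans (s≤s y<t)) t<zs)) ≅-refl ⟩
  (zs ++ [ y ]) ++ ys  ≡⟨ ++-assoc zs [ y ] ys ⟩
  zs ++ y ∷ ys         ∎
  where open SetoidReasoning ≅-setoid

-- Demazure equivalence is a congruence

-- A permutation w together with w⁻¹. The left Demazure product s_k ⋆ w is
-- (w⁻¹ ⋆ s_k)⁻¹, so leftStep is rightStep on the swapped pair.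
Pair : Set
Pair = Fun × Fun

rightStep : Pair → ℕ → Pair
rightStep (f , g) k = if f k <ᵇ f (suc k) then ((λ x → f (s k x)) , (λ x → s k (g x))) else (f , g)

leftStep : Pair → ℕ → Pair
leftStep p k = swap (rightStep (swap p) k)

infix 4 _≋_

record _≋_ (p q : Pair) : Set where
  constructor _,_
  field
    proj₁-≗ : proj₁ p ≗ proj₁ q
    proj₂-≗ : proj₂ p ≗ proj₂ q
open _≋_

≋-refl : ∀ {p} → p ≋ p
≋-refl = (λ _ → refl) , (λ _ → refl)

≋-sym : ∀ {p q} → p ≋ q → q ≋ p
≋-sym (f≗ , g≗) = (λ x → sym (f≗ x)) , (λ x → sym (g≗ x))

≋-trans : ∀ {p q r} → p ≋ q → q ≋ r → p ≋ r
≋-trans (f≗ , g≗) (f≗′ , g≗′) = (λ x → trans (f≗ x) (f≗′ x)) ,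
                                (λ x → trans (g≗ x) (g≗′ x))

≋-swap : ∀ {p q} → p ≋ q → swap p ≋ swap q
≋-swap (f≗ , g≗) = g≗ , f≗

record IsInversePair (p : Pair) : Set where
  constructor _,_
  field
    inverseˡ : ∀ x → proj₁ p (proj₂ p x) ≡ x
    inverseʳ : ∀ x → proj₂ p (proj₁ p x) ≡ x
open IsInversePair

isInversePair-swap : ∀ {p} → IsInversePair p → IsInversePair (swap p)
isInversePair-swap (fg , gf) = gf , fg

rightStep-cong : ∀ {p q} → p ≋ q → ∀ k → rightStep p k ≋ rightStep q k
rightStep-cong {f , g} {f′ , g′} (f≗ , g≗) k rewrite f≗ k | f≗ (suc k) with f′ k <ᵇ f′ (suc k)
... | true  = (λ x → f≗ (s k x)) , (λ x → cong (s k) (g≗ x))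
... | false = f≗ , g≗

leftStep-cong : ∀ {p q} → p ≋ q → ∀ k → leftStep p k ≋ leftStep q k
leftStep-cong p≋q k = ≋-swap (rightStep-cong (≋-swap p≋q) k)

rightStep-inverse : ∀ {p} → IsInversePair p → ∀ k → IsInversePair (rightStep p k)
rightStep-inverse {f , g} (fg , gf) k with f k <ᵇ f (suc k)
... | true  = (λ x → trans (cong f (s-involutive k (g x))) (fg x))
            , (λ x → trans (cong (s k) (gf (s k x))) (s-involutive k x))
... | false = fg , gf

leftStep-inverse : ∀ {p} → IsInversePair p → ∀ k → IsInversePair (leftStep p k)
leftStep-inverse inv k = isInversePair-swap (rightStep-inverse (isInversePair-swap inv) k)

inverse-at : ∀ {f g} → IsInversePair (f , g) → f j ≡ i → g i ≡ j
inverse-at {j} {f = f} {g} inv fj≡i = trans (cong g (sym fj≡i)) (inverseʳ inv j)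

s-intertwine : ∀ {f g} → IsInversePair (f , g) → f j ≡ i → f (suc j) ≡ suc i →
               ∀ x → f (s j x) ≡ s i (f x)
s-intertwine {j} {i} {f} {g} inv fj≡i fj+1≡i+1 x with x ≟ j
... | yes refl rewrite s-i≡1+i x | fj≡i | fj+1≡i+1 | s-i≡1+i i = refl
... | no x≢j with x ≟ suc j
...   | yes refl rewrite s-1+i≡i j | fj≡i | fj+1≡i+1 | s-1+i≡i i = refl
...   | no x≢j+1 rewrite s-fix x≢j x≢j+1 =
  sym (s-fix (x≢j ∘′ preimage fj≡i) (x≢j+1 ∘′ preimage fj+1≡i+1))
  where
  preimage : ∀ {y z} → f y ≡ z → f x ≡ z → x ≡ y
  preimage fy≡z fx≡z = trans (sym (inverseʳ inv x)) (trans (cong g fx≡z) (inverse-at inv fy≡z))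

≡⇒≋ : ∀ {p q} → p ≡ q → p ≋ q
≡⇒≋ refl = ≋-refl

sIf : Bool → ℕ → Fun
sIf true  k = s k
sIf false k = λ x → x

sIf-<ᵇ : ∀ c → ¬ (a ≡ i × b ≡ suc i) → ¬ (a ≡ suc i × b ≡ i) →
         (sIf c i a <ᵇ sIf c i b) ≡ (a <ᵇ b)
sIf-<ᵇ true  = s-<ᵇ
sIf-<ᵇ false _ _ = refl

module _ (f g : Fun) (k : ℕ) where
  rightStep-≡ : ∀ {b} → (f k <ᵇ f (suc k)) ≡ b →
                rightStep (f , g) k ≡ ((λ x → f (sIf b k x)) , (λ x → sIf b k (g x)))
  rightStep-≡ {true}  asc  rewrite asc  = refl
  rightStep-≡ {false} desc rewrite desc = refl

  leftStep-≡ : ∀ {c} → (g k <ᵇ g (suc k)) ≡ c →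
               leftStep (f , g) k ≡ ((λ x → sIf c k (f x)) , (λ x → g (sIf c k x)))
  leftStep-≡ {true}  asc  rewrite asc  = refl
  leftStep-≡ {false} desc rewrite desc = refl

ascent : a ≡ i → b ≡ suc i → (a <ᵇ b) ≡ true
ascent {i = i} a≡i b≡i+1 = trans (cong₂ _<ᵇ_ a≡i b≡i+1) (n<ᵇ1+n i)

descent : a ≡ suc i → b ≡ i → (a <ᵇ b) ≡ false
descent {i = i} a≡i+1 b≡i = trans (cong₂ _<ᵇ_ a≡i+1 b≡i) (1+n<ᵇn i)

s-descent : a ≡ i → b ≡ suc i → (s i a <ᵇ s i b) ≡ false
s-descent {i = i} refl refl = descent (s-i≡1+i i) (s-1+i≡i i)

leftStep-rightStep-comm-unlinked : ∀ f g i j {b c} →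
  (f j <ᵇ f (suc j)) ≡ b → (sIf c i (f j) <ᵇ sIf c i (f (suc j))) ≡ b →
  (g i <ᵇ g (suc i)) ≡ c → (sIf b j (g i) <ᵇ sIf b j (g (suc i))) ≡ c →
  leftStep (rightStep (f , g) j) i ≋ rightStep (leftStep (f , g) i) j
leftStep-rightStep-comm-unlinked f g i j {b} {c} fAsc fTest gAsc gTest = ≡⇒≋ (trans
  (trans (cong (λ p → leftStep p i) (rightStep-≡ f g j fAsc))
         (leftStep-≡ (λ x → f (sIf b j x)) (λ x → sIf b j (g x)) i gTest))
  (sym (trans (cong (λ p → rightStep p j) (leftStep-≡ f g i gAsc))
              (rightStep-≡ (λ x → sIf c i (f x)) (λ x → g (sIf c i x)) j fTest))))

-- Associativity (s_i ⋆ w) ⋆ s_j = s_i ⋆ (w ⋆ s_j). Unless {w(j), w(j+1)} = {i, i+1},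
-- neither step changes the ascent test of the other; if w(j) = i and w(j+1) = i+1 then
-- w s_j = s_i w, and in the opposite order both tests fail.
leftStep-rightStep-comm : ∀ f g i j → IsInversePair (f , g) →
                          leftStep (rightStep (f , g) j) i ≋ rightStep (leftStep (f , g) i) j
leftStep-rightStep-comm f g i j inv with (f j ≟ i) ×-dec (f (suc j) ≟ suc i)
... | yes (fj≡i , fj+1≡i+1) = ≋-trans (≡⇒≋ lhs) (≋-trans (fs≗sf , gs≗sg) (≡⇒≋ (sym rhs)))
  where
  gi≡j = inverse-at inv fj≡i
  gi+1≡j+1 = inverse-at inv fj+1≡i+1
  fs≗sf : (λ x → f (s j x)) ≗ (λ x → s i (f x))
  fs≗sf = s-intertwine inv fj≡i fj+1≡i+1
  gs≗sg : (λ x → s j (g x)) ≗ (λ x → g (s i x))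
  gs≗sg x = sym (s-intertwine (isInversePair-swap inv) gi≡j gi+1≡j+1 x)
  lhs : leftStep (rightStep (f , g) j) i ≡ ((λ x → f (s j x)) , (λ x → s j (g x)))
  lhs = trans (cong (λ p → leftStep p i) (rightStep-≡ f g j (ascent fj≡i fj+1≡i+1)))
              (leftStep-≡ (λ x → f (s j x)) (λ x → s j (g x)) i (s-descent gi≡j gi+1≡j+1))
  rhs : rightStep (leftStep (f , g) i) j ≡ ((λ x → s i (f x)) , (λ x → g (s i x)))
  rhs = trans (cong (λ p → rightStep p j) (leftStep-≡ f g i (ascent gi≡j gi+1≡j+1)))
              (rightStep-≡ (λ x → s i (f x)) (λ x → g (s i x)) j (s-descent fj≡i fj+1≡i+1))
... | no ¬A with (f j ≟ suc i) ×-dec (f (suc j) ≟ i)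
...   | yes (fj≡i+1 , fj+1≡i) = leftStep-rightStep-comm-unlinked f g i j fDesc fDesc gDesc gDesc
  where
  fDesc = descent fj≡i+1 fj+1≡i
  gDesc = descent (inverse-at inv fj+1≡i) (inverse-at inv fj≡i+1)
...   | no ¬B = leftStep-rightStep-comm-unlinked f g i j
                  refl (sIf-<ᵇ (g i <ᵇ g (suc i)) ¬A ¬B) refl (sIf-<ᵇ (f j <ᵇ f (suc j)) ¬A′ ¬B′)
  where
  inv′ = isInversePair-swap inv
  ¬A′ : ¬ (g i ≡ j × g (suc i) ≡ suc j)
  ¬A′ (gi≡j , gi+1≡j+1) = ¬A (inverse-at inv′ gi≡j , inverse-at inv′ gi+1≡j+1)
  ¬B′ : ¬ (g i ≡ suc j × g (suc i) ≡ j)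
  ¬B′ (gi≡j+1 , gi+1≡j) = ¬B (inverse-at inv′ gi+1≡j , inverse-at inv′ gi≡j+1)

rightRun : Pair → List ℕ → Pair
rightRun = foldl rightStep

leftRun : List ℕ → Pair → Pair
leftRun u p = foldr (λ k q → leftStep q k) p u

idPair : Pair
idPair = (λ x → x) , (λ x → x)

idPair-inverse : IsInversePair idPair
idPair-inverse = (λ _ → refl) , (λ _ → refl)

rightRun-cong : ∀ {p q} → p ≋ q → ∀ u → rightRun p u ≋ rightRun q u
rightRun-cong p≋q []      = p≋q
rightRun-cong p≋q (k ∷ u) = rightRun-cong (rightStep-cong p≋q k) u

leftRun-cong : ∀ {p q} → p ≋ q → ∀ u → leftRun u p ≋ leftRun u q
leftRun-cong p≋q []      = p≋q
leftRun-cong p≋q (k ∷ u) = leftStep-cong (leftRun-cong p≋q u) k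

rightRun-inverse : ∀ {p} → IsInversePair p → ∀ u → IsInversePair (rightRun p u)
rightRun-inverse inv []      = inv
rightRun-inverse inv (k ∷ u) = rightRun-inverse (rightStep-inverse inv k) u

leftRun-inverse : ∀ {p} → IsInversePair p → ∀ u → IsInversePair (leftRun u p)
leftRun-inverse inv []      = inv
leftRun-inverse inv (k ∷ u) = leftStep-inverse (leftRun-inverse inv u) k

rightRun-leftStep : ∀ {p} → IsInversePair p → ∀ i u → rightRun (leftStep p i) u ≋ leftStep (rightRun p u) i
rightRun-leftStep         inv i []      = ≋-refl
rightRun-leftStep {f , g} inv i (k ∷ u) =
  ≋-trans (rightRun-cong (≋-sym (leftStep-rightStep-comm f g i k inv)) u)
          (rightRun-leftStep (rightStep-inverse inv k) i u)

rightRun-leftRun : ∀ {p} → IsInversePair p → ∀ a u → rightRun (leftRun a p) u ≋ leftRun a (rightRun p u)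
rightRun-leftRun inv []      u = ≋-refl
rightRun-leftRun inv (k ∷ a) u =
  ≋-trans (rightRun-leftStep (leftRun-inverse inv a) k u) (leftStep-cong (rightRun-leftRun inv a u) k)

rightStep-idPair : ∀ k → rightStep idPair k ≡ leftStep idPair k
rightStep-idPair k rewrite n<ᵇ1+n k = refl

rightRun-leftRun-idPair : ∀ a b → rightRun (leftRun b idPair) a ≋ leftRun (b ++ a) idPair
rightRun-leftRun-idPair []      b rewrite ++-identityʳ b = ≋-refl
rightRun-leftRun-idPair (k ∷ a) b =
  ≋-trans (rightRun-cong step a)
          (≋-trans (rightRun-leftRun-idPair a (b ++ [ k ]))
                   (≡⇒≋ (cong (λ c → leftRun c idPair) (++-assoc b [ k ] a))))
  where
  step : rightStep (leftRun b idPair) k ≋ leftRun (b ++ [ k ]) idPair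
  step = ≋-trans (rightRun-leftRun idPair-inverse b [ k ])
                 (≡⇒≋ (trans (cong (leftRun b) (rightStep-idPair k))
                             (sym (foldr-++ (λ k q → leftStep q k) idPair b [ k ]))))

proj₁-rightRun : ∀ p u → proj₁ (rightRun p u) ≗ demazureFrom (proj₁ p) u
proj₁-rightRun p       []      x = refl
proj₁-rightRun (f , g) (k ∷ u) x = trans (proj₁-rightRun (rightStep (f , g) k) u x) (demazureFrom-cong step u x)
  where
  step : proj₁ (rightStep (f , g) k) ≗ demStep f k
  step y with f k <ᵇ f (suc k)
  ... | true  = refl
  ... | false = refl

inverse-unique : ∀ {p q} → IsInversePair p → IsInversePair q →
                 proj₁ p ≗ proj₁ q → proj₂ p ≗ proj₂ q
inverse-unique {f , g} {f′ , g′} inv inv′ f≗f′ x =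
  trans (cong g (sym (inverseˡ inv′ x))) (trans (cong g (sym (f≗f′ (g′ x)))) (inverseʳ inv (g′ x)))

infix 4 _∼_

record _∼_ (u v : List ℕ) : Set where
  constructor mk∼
  field
    ∼⇒≗ : demazure u ≗ demazure v
open _∼_

∼-setoid : Setoid _ _
∼-setoid = record
  { Carrier       = List ℕ
  ; _≈_           = _∼_
  ; isEquivalence = record
    { refl  = mk∼ λ x → refl
    ; sym   = λ u∼v → mk∼ λ x → sym (∼⇒≗ u∼v x)
    ; trans = λ u∼v v∼w → mk∼ λ x → trans (∼⇒≗ u∼v x) (∼⇒≗ v∼w x)
    }
  }

≅⇒∼ : ∀ {u v} → u ≅ v → u ∼ v
≅⇒∼ u≅v = mk∼ (≅⇒≗ u≅v (λ x → x))

∼⇒rightRun≋ : ∀ {u v} → u ∼ v → rightRun idPair u ≋ rightRun idPair v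
∼⇒rightRun≋ {u} {v} u∼v =
  proj₁≗ , inverse-unique (rightRun-inverse idPair-inverse u) (rightRun-inverse idPair-inverse v) proj₁≗
  where
  proj₁≗ : proj₁ (rightRun idPair u) ≗ proj₁ (rightRun idPair v)
  proj₁≗ x = trans (proj₁-rightRun idPair u x) (trans (∼⇒≗ u∼v x) (sym (proj₁-rightRun idPair v x)))

rightRun-++ : ∀ a u → rightRun idPair (a ++ u) ≋ leftRun a (rightRun idPair u)
rightRun-++ a u = ≋-trans (≡⇒≋ (foldl-++ rightStep idPair a u))
  (≋-trans (rightRun-cong (rightRun-leftRun-idPair a []) u) (rightRun-leftRun idPair-inverse a u))

∼-congˡ : ∀ a {u v} → u ∼ v → a ++ u ∼ a ++ v
∼-congˡ a {u} {v} u∼v = mk∼ λ x → begin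
  demazure (a ++ u) x                        ≡⟨ proj₁-rightRun idPair (a ++ u) x ⟨
  proj₁ (rightRun idPair (a ++ u)) x         ≡⟨ proj₁-≗ (rightRun-++ a u) x ⟩
  proj₁ (leftRun a (rightRun idPair u)) x    ≡⟨ proj₁-≗ (leftRun-cong (∼⇒rightRun≋ u∼v) a) x ⟩
  proj₁ (leftRun a (rightRun idPair v)) x    ≡⟨ proj₁-≗ (rightRun-++ a v) x ⟨
  proj₁ (rightRun idPair (a ++ v)) x         ≡⟨ proj₁-rightRun idPair (a ++ v) x ⟩
  demazure (a ++ v) x                        ∎
  where open ≡-Reasoning

∼-congʳ : ∀ {u v} → u ∼ v → ∀ b → u ++ b ∼ v ++ b
∼-congʳ {u} {v} u∼v b = mk∼ λ x →
  trans (demazureFrom-++ _ u b x) (trans (demazureFrom-cong (∼⇒≗ u∼v) b x) (sym (demazureFrom-++ _ v b x)))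

∼-++ : ∀ {u u′ v v′} → u ∼ u′ → v ∼ v′ → u ++ v ∼ u′ ++ v′
∼-++ {u′ = u′} {v} u∼u′ v∼v′ = Setoid.trans ∼-setoid (∼-congʳ u∼u′ v) (∼-congˡ u′ v∼v′)

swap-leftRun-idPair : ∀ v → swap (foldr (flip rightStep) idPair v) ≡ leftRun v idPair
swap-leftRun-idPair []      = refl
swap-leftRun-idPair (k ∷ v) = cong (λ q → leftStep q k) (swap-leftRun-idPair v)

demazure-reverse : ∀ v → demazure (reverse v) ≗ proj₂ (rightRun idPair v)
demazure-reverse v x = begin
  demazure (reverse v) x                       ≡⟨ proj₁-rightRun idPair (reverse v) x ⟨
  proj₁ (rightRun idPair (reverse v)) x        ≡⟨ cong (λ p → proj₁ p x) (reverse-foldl rightStep idPair v) ⟩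
  proj₁ (foldr (flip rightStep) idPair v) x    ≡⟨ cong (λ p → proj₂ p x) (swap-leftRun-idPair v) ⟩
  proj₂ (leftRun v idPair) x                   ≡⟨ proj₂-≗ (rightRun-leftRun-idPair v []) x ⟨
  proj₂ (rightRun idPair v) x                  ∎
  where open ≡-Reasoning

∼-reverse : ∀ {u v} → u ∼ v → reverse u ∼ reverse v
∼-reverse {u} {v} u∼v = mk∼ λ x →
  trans (demazure-reverse u x) (trans (proj₂-≗ (∼⇒rightRun≋ u∼v) x) (sym (demazure-reverse v x)))

-- Shifting and reflecting letters

demazureFrom-shift-below : ∀ n u → All (0 <_) u → ∀ f x → x ≤ n → demazureFrom f (map (n +_) u) x ≡ f x
demazureFrom-shift-below n []      _          f x x≤n = refl
demazureFrom-shift-below n (k ∷ u) (0<k ∷ 0<u) f x x≤n =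
  trans (demazureFrom-shift-below n u 0<u (demStep f (n + k)) x x≤n) step
  where
  x<n+k : x < n + k
  x<n+k = ≤-<-trans x≤n (m<m+n n 0<k)
  step : demStep f (n + k) x ≡ f x
  step with f (n + k) <ᵇ f (suc (n + k))
  ... | true  = cong f (s-fix-below x<n+k)
  ... | false = refl

demazureFrom-shift : ∀ n u f x → demazureFrom f (map (n +_) u) (n + x) ≡ demazureFrom (λ y → f (n + y)) u x
demazureFrom-shift n []      f x = refl
demazureFrom-shift n (k ∷ u) f x = trans (demazureFrom-shift n u (demStep f (n + k)) x) (demazureFrom-cong step u x)
  where
  step : (λ y → demStep f (n + k) (n + y)) ≗ demStep (λ y → f (n + y)) k
  step y rewrite +-suc n k with f (n + k) <ᵇ f (suc (n + k))
  ... | true  = cong f (s-+ n k y)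
  ... | false = refl

+-<ᵇ : ∀ n a b → (n + a <ᵇ n + b) ≡ (a <ᵇ b)
+-<ᵇ zero    a b = refl
+-<ᵇ (suc n) a b = +-<ᵇ n a b

demazureFrom-+ : ∀ n u f x → demazureFrom (λ y → n + f y) u x ≡ n + demazureFrom f u x
demazureFrom-+ n []      f x = refl
demazureFrom-+ n (k ∷ u) f x = trans (demazureFrom-cong step u x) (demazureFrom-+ n u (demStep f k) x)
  where
  step : demStep (λ y → n + f y) k ≗ (λ y → n + demStep f k y)
  step y rewrite +-<ᵇ n (f k) (f (suc k)) with f k <ᵇ f (suc k)
  ... | true  = refl
  ... | false = refl

∼-shift : ∀ n {u v} → All (0 <_) u → All (0 <_) v → u ∼ v → map (n +_) u ∼ map (n +_) v
∼-shift n {u} {v} 0<u 0<v u∼v = mk∼ shifted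
  where
  shifted : demazure (map (n +_) u) ≗ demazure (map (n +_) v)
  shifted x with x ≤? n
  ... | yes x≤n =
    trans (demazureFrom-shift-below n u 0<u _ x x≤n) (sym (demazureFrom-shift-below n v 0<v _ x x≤n))
  ... | no x≰n rewrite sym (m+[n∸m]≡n (<⇒≤ (≰⇒> x≰n))) = begin
    demazure (map (n +_) u) (n + (x ∸ n))  ≡⟨ demazureFrom-shift n u _ (x ∸ n) ⟩
    demazureFrom (n +_) u (x ∸ n)           ≡⟨ demazureFrom-+ n u _ (x ∸ n) ⟩
    n + demazure u (x ∸ n)                  ≡⟨ cong (n +_) (∼⇒≗ u∼v (x ∸ n)) ⟩
    n + demazure v (x ∸ n)                  ≡⟨ demazureFrom-+ n v _ (x ∸ n) ⟨
    demazureFrom (n +_) v (x ∸ n)           ≡⟨ demazureFrom-shift n v _ (x ∸ n) ⟨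
    demazure (map (n +_) v) (n + (x ∸ n))  ∎
    where open ≡-Reasoning

n<m⇒m∸n≡1+m∸[1+n] : ∀ {m n} → n < m → m ∸ n ≡ suc (m ∸ suc n)
n<m⇒m∸n≡1+m∸[1+n] {suc m} (s≤s n≤m) = +-∸-assoc 1 n≤m

module Reflection (N : ℕ) where

  InRange : ℕ → Set
  InRange x = 0 < x × x ≤ N

  -- The longest element y ↦ N + 1 − y of S_N on 1, …, N, the identity elsewhere;
  -- it conjugates s_k to s_{N−k}.
  w₀ : ℕ → ℕ
  w₀ zero    = zero
  w₀ (suc x) = if x <ᵇ N then N ∸ x else suc x

  w₀-inside : ∀ {x} → x < N → w₀ (suc x) ≡ N ∸ x
  w₀-inside x<N rewrite <⇒<ᵇ≡true x<N = refl

  w₀-outside : ∀ {x} → ¬ x < N → w₀ (suc x) ≡ suc x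
  w₀-outside x≮N rewrite ≮⇒<ᵇ≡false x≮N = refl

  w₀-inRange : ∀ {k} → InRange k → w₀ k ≡ suc (N ∸ k)
  w₀-inRange {suc k} (_ , k<N) = trans (w₀-inside k<N) (n<m⇒m∸n≡1+m∸[1+n] k<N)

  w₀-involutive : ∀ x → w₀ (w₀ x) ≡ x
  w₀-involutive zero = refl
  w₀-involutive (suc x) with x <? N
  ... | yes x<N rewrite w₀-inside x<N | n<m⇒m∸n≡1+m∸[1+n] x<N =
    trans (w₀-inside (∸-monoʳ-< z<s x<N)) (m∸[m∸n]≡n x<N)
  ... | no x≮N rewrite w₀-outside x≮N = w₀-outside x≮N

  w₀-injective : ∀ {x y} → w₀ x ≡ w₀ y → x ≡ y
  w₀-injective {x} {y} eq = trans (sym (w₀-involutive x)) (trans (cong w₀ eq) (w₀-involutive y))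

  w₀-<ᵇ : ∀ {a b} → InRange a → InRange b → (w₀ b <ᵇ w₀ a) ≡ (a <ᵇ b)
  w₀-<ᵇ {suc a} {suc b} (_ , a<N) (_ , b<N) rewrite w₀-inside a<N | w₀-inside b<N = <ᵇ-cong to from
    where
    to : N ∸ b < N ∸ a → suc a < suc b
    to N∸b<N∸a with a <? b
    ... | yes a<b = s<s a<b
    ... | no  a≮b = ⊥-elim (<⇒≱ N∸b<N∸a (∸-monoʳ-≤ N (≮⇒≥ a≮b)))
    from : suc a < suc b → N ∸ b < N ∸ a
    from (s≤s a<b) = ∸-monoʳ-< a<b (<⇒≤ b<N)

  s-w₀ : ∀ {k} → 0 < k → k < N → ∀ x → s (N ∸ k) (w₀ x) ≡ w₀ (s k x)
  s-w₀ {k} 0<k k<N x with x ≟ k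
  ... | yes refl rewrite w₀-inRange (0<k , <⇒≤ k<N) | s-1+i≡i (N ∸ x) | s-i≡1+i x | w₀-inside k<N = refl
  ... | no x≢k with x ≟ suc k
  ...   | yes refl rewrite w₀-inside k<N | s-i≡1+i (N ∸ k) | s-1+i≡i k | w₀-inRange (0<k , <⇒≤ k<N) = refl
  ...   | no x≢k+1 rewrite s-fix x≢k x≢k+1 = s-fix w₀x≢N∸k w₀x≢1+N∸k
    where
    w₀x≢N∸k : w₀ x ≢ N ∸ k
    w₀x≢N∸k eq = x≢k+1 (w₀-injective (trans eq (sym (w₀-inside k<N))))
    w₀x≢1+N∸k : w₀ x ≢ suc (N ∸ k)
    w₀x≢1+N∸k eq = x≢k (w₀-injective (trans eq (sym (w₀-inRange (0<k , <⇒≤ k<N)))))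

  s-inRange : ∀ {i x} → 0 < i → suc i ≤ N → InRange x → InRange (s i x)
  s-inRange {i} {x} 0<i i<N x∈ with x ≟ i
  ... | yes refl rewrite s-i≡1+i x = z<s , i<N
  ... | no x≢i with x ≟ suc i
  ...   | yes refl rewrite s-1+i≡i i = 0<i , <⇒≤ i<N
  ...   | no x≢i+1 rewrite s-fix x≢i x≢i+1 = x∈

  PreservesRange : Fun → Set
  PreservesRange f = ∀ {x} → InRange x → InRange (f x)

  Letter : ℕ → Set
  Letter k = 0 < k × k < N

  reflected-inRange : ∀ {k} → Letter k → InRange (N ∸ k) × InRange (suc (N ∸ k))
  reflected-inRange {suc k} (_ , k<N) =
    (m<n⇒0<n∸m k<N , m∸n≤m N (suc k)) , (z<s , ∸-monoʳ-< z<s (<⇒≤ k<N))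

  demStep-preservesRange : ∀ {f} → PreservesRange f → ∀ {k} → Letter k →
                           PreservesRange (demStep f (N ∸ k))
  demStep-preservesRange {f} f∈ {k} k∈ x∈ with f (N ∸ k) <ᵇ f (suc (N ∸ k)) | reflected-inRange k∈
  ... | true  | (0<N∸k , _) , (_ , N∸k<N) = f∈ (s-inRange 0<N∸k N∸k<N x∈)
  ... | false | _                        = f∈ x∈

  w₀-demazureFrom : ∀ u → All Letter u → ∀ f → PreservesRange f → ∀ x →
    w₀ (demazureFrom f (map (N ∸_) u) (w₀ x)) ≡ demazureFrom (λ y → w₀ (f (w₀ y))) u x
  w₀-demazureFrom []      _          f f∈ x = refl
  w₀-demazureFrom (k ∷ u) (k∈ ∷ u∈) f f∈ x =
    trans (w₀-demazureFrom u u∈ (demStep f (N ∸ k)) (demStep-preservesRange f∈ k∈) x)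
          (demazureFrom-cong step u x)
    where
    step : (λ y → w₀ (demStep f (N ∸ k) (w₀ y))) ≗ demStep (λ y → w₀ (f (w₀ y))) k
    step y rewrite w₀-inRange (proj₁ k∈ , <⇒≤ (proj₂ k∈)) | w₀-inside (proj₂ k∈)
                 | w₀-<ᵇ (f∈ (proj₁ (reflected-inRange k∈))) (f∈ (proj₂ (reflected-inRange k∈)))
      with f (N ∸ k) <ᵇ f (suc (N ∸ k))
    ... | true  = cong (λ z → w₀ (f z)) (s-w₀ (proj₁ k∈) (proj₂ k∈) y)
    ... | false = refl

  w₀-demazure : ∀ u → All Letter u → ∀ x → w₀ (demazure (map (N ∸_) u) (w₀ x)) ≡ demazure u x
  w₀-demazure u u∈ x =
    trans (w₀-demazureFrom u u∈ (λ y → y) (λ y∈ → y∈) x) (demazureFrom-cong w₀-involutive u x)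

  ∼-reflect⁻ : ∀ {u v} → All Letter u → All Letter v → map (N ∸_) u ∼ map (N ∸_) v → u ∼ v
  ∼-reflect⁻ {u} {v} u∈ v∈ Nu∼Nv = mk∼ λ x →
    trans (sym (w₀-demazure u u∈ x)) (trans (cong w₀ (∼⇒≗ Nu∼Nv (w₀ x))) (w₀-demazure v v∈ x))

-- Words of pipe dreams

upTo-< : ∀ m → All (_< m) (upTo m)
upTo-< zero    = []
upTo-< (suc m) = ++⁺ (All.map m<n⇒m<1+n (upTo-< m)) (n<1+n m ∷ [])

downFrom-< : ∀ m → All (_< m) (downFrom m)
downFrom-< zero    = []
downFrom-< (suc m) = n<1+n m ∷ All.map m<n⇒m<1+n (downFrom-< m)

reverse-upTo : ∀ m → reverse (upTo m) ≡ downFrom m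
reverse-upTo zero    = refl
reverse-upTo (suc m) = trans (reverse-++ (upTo m) [ m ]) (cong (m ∷_) (reverse-upTo m))

downFrom-suc : ∀ m → downFrom (suc m) ≡ map suc (downFrom m) ++ [ 0 ]
downFrom-suc zero    = refl
downFrom-suc (suc m) = cong (suc m ∷_) (downFrom-suc m)

reverse-downFrom : ∀ m → reverse (downFrom m) ≡ upTo m
reverse-downFrom m = trans (cong reverse (sym (reverse-upTo m))) (reverse-involutive (upTo m))

map-flip-upTo : ∀ m → map (λ i → m ∸ suc i) (upTo m) ≡ downFrom m
map-flip-upTo zero    = refl
map-flip-upTo (suc m) = begin
  map (λ i → m ∸ i) (upTo m ++ [ m ])
    ≡⟨ map-++ _ (upTo m) [ m ] ⟩
  map (λ i → m ∸ i) (upTo m) ++ [ m ∸ m ]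
    ≡⟨ cong₂ _++_ (map-cong-local (All.map n<m⇒m∸n≡1+m∸[1+n] (upTo-< m))) (cong [_] (n∸n≡0 m)) ⟩
  map (λ i → suc (m ∸ suc i)) (upTo m) ++ [ 0 ]
    ≡⟨ cong (_++ [ 0 ]) (trans (map-∘ (upTo m)) (cong (map suc) (map-flip-upTo m))) ⟩
  map suc (downFrom m) ++ [ 0 ]
    ≡⟨ downFrom-suc m ⟨
  downFrom (suc m) ∎
  where open ≡-Reasoning

map-flip-downFrom : ∀ m → map (λ i → m ∸ suc i) (downFrom m) ≡ upTo m
map-flip-downFrom m = begin
  map (λ i → m ∸ suc i) (downFrom m)            ≡⟨ cong (map _) (reverse-upTo m) ⟨
  map (λ i → m ∸ suc i) (reverse (upTo m))      ≡⟨ reverse-map _ (upTo m) ⟩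
  reverse (map (λ i → m ∸ suc i) (upTo m))      ≡⟨ cong reverse (map-flip-upTo m) ⟩
  reverse (downFrom m)                          ≡⟨ reverse-downFrom m ⟩
  upTo m                                        ∎
  where open ≡-Reasoning

reverse-concatMap : ∀ (f : ℕ → List ℕ) xs →
                    reverse (concatMap f xs) ≡ concatMap (λ x → reverse (f x)) (reverse xs)
reverse-concatMap f []       = refl
reverse-concatMap f (x ∷ xs) = begin
  reverse (f x ++ concatMap f xs)                 ≡⟨ reverse-++ (f x) (concatMap f xs) ⟩
  reverse (concatMap f xs) ++ reverse (f x)       ≡⟨ cong (_++ reverse (f x)) (reverse-concatMap f xs) ⟩
  concatMap f′ (reverse xs) ++ reverse (f x)      ≡⟨ cong (concatMap f′ (reverse xs) ++_) (++-identityʳ (f′ x)) ⟨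
  concatMap f′ (reverse xs) ++ concatMap f′ [ x ] ≡⟨ concatMap-++ f′ (reverse xs) [ x ] ⟨
  concatMap f′ (reverse xs ++ [ x ])              ≡⟨ cong (concatMap f′) (unfold-reverse x xs) ⟨
  concatMap f′ (reverse (x ∷ xs))                 ∎
  where
  open ≡-Reasoning
  f′ = λ y → reverse (f y)

reverse-grid : ∀ m n (g : ℕ → ℕ → List ℕ) → (∀ i j → reverse (g i j) ≡ g i j) →
  reverse (concatMap (λ i → concatMap (g i) (downFrom n)) (upTo m))
  ≡ concatMap (λ i → concatMap (λ j → g (m ∸ suc i) (n ∸ suc j)) (downFrom n)) (upTo m)
reverse-grid m n g g-reverse = begin
  reverse (concatMap row (upTo m))
    ≡⟨ reverse-concatMap row (upTo m) ⟩
  concatMap (λ i → reverse (row i)) (reverse (upTo m))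
    ≡⟨ cong (concatMap _) (trans (reverse-upTo m) (sym (map-flip-upTo m))) ⟩
  concatMap (λ i → reverse (row i)) (map (λ i → m ∸ suc i) (upTo m))
    ≡⟨ concatMap-map _ _ (upTo m) ⟩
  concatMap (λ i → reverse (row (m ∸ suc i))) (upTo m)
    ≡⟨ concatMap-cong (λ i → reverse-row (m ∸ suc i)) (upTo m) ⟩
  concatMap (λ i → concatMap (λ j → g (m ∸ suc i) (n ∸ suc j)) (downFrom n)) (upTo m) ∎
  where
  open ≡-Reasoning
  row = λ i → concatMap (g i) (downFrom n)
  reverse-row : ∀ i → reverse (row i) ≡ concatMap (λ j → g i (n ∸ suc j)) (downFrom n)
  reverse-row i = begin
    reverse (row i)
      ≡⟨ reverse-concatMap (g i) (downFrom n) ⟩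
    concatMap (λ j → reverse (g i j)) (reverse (downFrom n))
      ≡⟨ concatMap-cong (g-reverse i) (reverse (downFrom n)) ⟩
    concatMap (g i) (reverse (downFrom n))
      ≡⟨ cong (concatMap (g i)) (trans (reverse-downFrom n) (sym (map-flip-downFrom n))) ⟩
    concatMap (g i) (map (λ j → n ∸ suc j) (downFrom n))
      ≡⟨ concatMap-map (g i) _ (downFrom n) ⟩
    concatMap (λ j → g i (n ∸ suc j)) (downFrom n) ∎

concatMap-cong-local : ∀ {f g : ℕ → List ℕ} {xs} → All (λ x → f x ≡ g x) xs →
                       concatMap f xs ≡ concatMap g xs
concatMap-cong-local f≡g = cong concat (map-cong-local f≡g)

upTo-+ : ∀ a b → upTo (a + b) ≡ upTo a ++ map (a +_) (upTo b)
upTo-+ a zero    rewrite +-identityʳ a = sym (++-identityʳ (upTo a))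
upTo-+ a (suc b) rewrite +-suc a b = begin
  upTo (a + b) ++ [ a + b ]                          ≡⟨ cong (_++ [ a + b ]) (upTo-+ a b) ⟩
  (upTo a ++ map (a +_) (upTo b)) ++ [ a + b ]       ≡⟨ ++-assoc (upTo a) _ [ a + b ] ⟩
  upTo a ++ map (a +_) (upTo b) ++ [ a + b ]         ≡⟨ cong (upTo a ++_) (map-++ (a +_) (upTo b) [ b ]) ⟨
  upTo a ++ map (a +_) (upTo b ++ [ b ])             ∎
  where open ≡-Reasoning

downFrom-+ : ∀ a b → downFrom (a + b) ≡ map (_+ b) (downFrom a) ++ downFrom b
downFrom-+ zero    b = refl
downFrom-+ (suc a) b = cong (a + b ∷_) (downFrom-+ a b)

concatMap-empty : ∀ {f : ℕ → List ℕ} {xs} → All (λ x → f x ≡ []) xs → concatMap f xs ≡ []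
concatMap-empty []              = refl
concatMap-empty (fx≡[] ∷ fxs≡[]) rewrite fx≡[] = concatMap-empty fxs≡[]

concatMap-upTo-suc : ∀ (f : ℕ → List ℕ) m → concatMap f (upTo (suc m)) ≡ concatMap f (upTo m) ++ f m
concatMap-upTo-suc f m = trans (concatMap-++ f (upTo m) [ m ]) (cong (concatMap f (upTo m) ++_) (++-identityʳ (f m)))

++-regroup : ∀ (u v w x : List ℕ) → (u ++ v) ++ (w ++ x) ≡ u ++ (v ++ w) ++ x
++-regroup u v w x = trans (++-assoc u v (w ++ x)) (cong (u ++_) (sym (++-assoc v w x)))

cell : PipeDream → ℕ → ℕ → List ℕ
cell P i j = if P i j then [ suc (i + j) ] else []

cell-empty : ∀ (P : PipeDream) i j → P i j ≡ false → cell P i j ≡ []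
cell-empty P i j P≡false rewrite P≡false = refl

cell-full : ∀ (P : PipeDream) i j → P i j ≡ true → cell P i j ≡ [ suc (i + j) ]
cell-full P i j P≡true rewrite P≡true = refl

cell-above : ∀ P i j → All (i <_) (cell P i j)
cell-above P i j with P i j
... | true  = s≤s (m≤m+n i j) ∷ []
... | false = []

cell-shift : ∀ {P P′ : PipeDream} {i j i′ j′} k → P i j ≡ P′ i′ j′ → suc (i + j) ≡ k + suc (i′ + j′) →
             cell P i j ≡ map (k +_) (cell P′ i′ j′)
cell-shift {P′ = P′} {i′ = i′} {j′} k P≡P′ letter rewrite P≡P′ with P′ i′ j′
... | true  = cong [_] letter
... | false = refl

rowWord-concatMap : ∀ P i js → rowWord P i js ≡ concatMap (cell P i) js
rowWord-concatMap P i []       = refl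
rowWord-concatMap P i (j ∷ js) = cong (cell P i j ++_) (rowWord-concatMap P i js)

pdWordRows-concatMap : ∀ P n is → pdWordRows P n is ≡ concatMap (λ i → concatMap (cell P i) (downFrom n)) is
pdWordRows-concatMap P n []       = refl
pdWordRows-concatMap P n (i ∷ is) = cong₂ _++_ (rowWord-concatMap P i (downFrom n)) (pdWordRows-concatMap P n is)

pdWord-concatMap : ∀ m n P → pdWord m n P ≡ concatMap (λ i → concatMap (cell P i) (downFrom n)) (upTo m)
pdWord-concatMap m n P = pdWordRows-concatMap P n (upTo m)

pdWord-letters : ∀ m n P → All (Reflection.Letter (m + n)) (pdWord m n P)
pdWord-letters m n P rewrite pdWord-concatMap m n P =
  concat⁺ (map⁺ (All.map (λ i<m → concat⁺ (map⁺ (All.map (cell-letters i<m) (downFrom-< n)))) (upTo-< m)))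
  where
  cell-letters : ∀ {i j} → i < m → j < n → All (Reflection.Letter (m + n)) (cell P i j)
  cell-letters {i} {j} i<m j<n with P i j
  ... | true  = (z<s , subst (_≤ m + n) (cong suc (+-suc i j)) (+-mono-≤ i<m j<n)) ∷ []
  ... | false = []

pdWord-positive : ∀ m n P → All (0 <_) (pdWord m n P)
pdWord-positive m n P = All.map proj₁ (pdWord-letters m n P)

rotated-letter : ∀ {m n i j} → i < m → j < n → (m + n) ∸ suc ((m ∸ suc i) + (n ∸ suc j)) ≡ suc (i + j)
rotated-letter {i = i} {j} i<m j<n with m≤n⇒∃[o]m+o≡n i<m | m≤n⇒∃[o]m+o≡n j<n
... | a , refl | b , refl rewrite m+n∸m≡n (suc i) a | m+n∸m≡n (suc j) b =
  trans (cong (_∸ suc (a + b)) (rearrange i a j b)) (m+n∸m≡n (suc (a + b)) (suc (i + j)))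
  where
  rearrange : ∀ i a j b → suc i + a + (suc j + b) ≡ suc (a + b) + suc (i + j)
  rearrange = solve-∀

cell-rot : ∀ {m n i j} P → i < m → j < n →
           map ((m + n) ∸_) (cell P (m ∸ suc i) (n ∸ suc j)) ≡ cell (rot m n P) i j
cell-rot {m} {n} {i} {j} P i<m j<n rewrite ∸-+-assoc m 1 i | ∸-+-assoc n 1 j with P (m ∸ suc i) (n ∸ suc j)
... | true  = cong [_] (rotated-letter i<m j<n)
... | false = refl

pdWord-rot : ∀ m n P → pdWord m n (rot m n P) ≡ reverse (map ((m + n) ∸_) (pdWord m n P))
pdWord-rot m n P = sym (begin
  reverse (map φ (pdWord m n P))
    ≡⟨ cong (reverse ∘′ map φ) (pdWord-concatMap m n P) ⟩
  reverse (map φ (concatMap (λ i → concatMap (cell P i) (downFrom n)) (upTo m)))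
    ≡⟨ cong reverse (trans (map-concatMap φ _ (upTo m))
                           (concatMap-cong (λ i → map-concatMap φ (cell P i) (downFrom n)) (upTo m))) ⟩
  reverse (concatMap (λ i → concatMap (λ j → map φ (cell P i j)) (downFrom n)) (upTo m))
    ≡⟨ reverse-grid m n (λ i j → map φ (cell P i j)) reverse-cell ⟩
  concatMap (λ i → concatMap (λ j → map φ (cell P (m ∸ suc i) (n ∸ suc j))) (downFrom n)) (upTo m)
    ≡⟨ concatMap-cong-local (All.map (λ i<m → concatMap-cong-local (All.map (cell-rot P i<m) (downFrom-< n)))
                                     (upTo-< m)) ⟩
  concatMap (λ i → concatMap (cell (rot m n P) i) (downFrom n)) (upTo m)
    ≡⟨ pdWord-concatMap m n (rot m n P) ⟨
  pdWord m n (rot m n P) ∎)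
  where
  open ≡-Reasoning
  φ = (m + n) ∸_
  reverse-cell : ∀ i j → reverse (map φ (cell P i j)) ≡ map φ (cell P i j)
  reverse-cell i j with P i j
  ... | true  = refl
  ... | false = refl

∼-rot⁻ : ∀ m n P P′ → pdWord m n (rot m n P) ∼ pdWord m n (rot m n P′) →
         pdWord m n P ∼ pdWord m n P′
∼-rot⁻ m n P P′ rotP∼rotP′ =
  Reflection.∼-reflect⁻ (m + n) (pdWord-letters m n P) (pdWord-letters m n P′) reflected
  where
  reflected : map ((m + n) ∸_) (pdWord m n P) ∼ map ((m + n) ∸_) (pdWord m n P′)
  reflected = subst₂ _∼_ (reverse-involutive _) (reverse-involutive _)
                (∼-reverse (subst₂ _∼_ (pdWord-rot m n P) (pdWord-rot m n P′) rotP∼rotP′))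

-- The block structure of P(P₁, …, Pₙ)

rest : (n : ℕ) → (Fin (suc n) → ℕ) → ℕ
rest zero    r = 0
rest (suc n) r = sumSizes n (λ i → r (fsuc i))

sumSizes-rest : ∀ n r → sumSizes n r ≡ r fzero + rest n r
sumSizes-rest zero    r = sym (+-identityʳ (r fzero))
sumSizes-rest (suc n) r = refl

locate-first : ∀ n r {a} → a < r fzero → locate n r a ≡ (fzero , a)
locate-first zero    r a<r₀ = refl
locate-first (suc n) r a<r₀ rewrite <⇒<ᵇ≡true a<r₀ = refl

locate-+ : ∀ n r a → locate (suc n) r (r fzero + a) ≡ map₁ fsuc (locate n (λ i → r (fsuc i)) a)
locate-+ n r a rewrite ≮⇒<ᵇ≡false (m+n≮m (r fzero) a) | m+n∸m≡n (r fzero) a = refl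

bigPD-unfold : ∀ n r Ps a c → bigPD n r Ps a c ≡
  let (j , ro) = locate n r a ; (i , coR) = locate n r (sumSizes n r ∸ 1 ∸ c)
  in  bigCross n r Ps j ro i (r i ∸ 1 ∸ coR)
bigPD-unfold n r Ps a c with locate n r a | locate n r (sumSizes n r ∸ 1 ∸ c)
... | j , ro | i , coR = refl

bigCross-suc : ∀ n r Ps j ro i co →
  bigCross (suc n) r Ps (fsuc j) ro (fsuc i) co ≡ bigCross n (λ k → r (fsuc k)) (λ k → Ps (fsuc k)) j ro i co
bigCross-suc n r Ps j ro i co with suc (suc (toℕ j)) ≤ᵇ toℕ i
... | true = refl
bigCross-suc n r Ps j ro fzero    co | false = refl
bigCross-suc n r Ps j ro (fsuc i) co | false = refl

∸1∸-< : ∀ {n j} → j < n → n ∸ 1 ∸ j < n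
∸1∸-< {suc n} {j} _ = s≤s (m∸n≤m n j)

∸1∸-involutive : ∀ {n j} → j < n → n ∸ 1 ∸ (n ∸ 1 ∸ j) ≡ j
∸1∸-involutive {suc n} (s≤s j≤n) = m∸[m∸n]≡n j≤n

∸1∸-+ˡ : ∀ m {n j} → j < n → (m + n) ∸ 1 ∸ j ≡ m + (n ∸ 1 ∸ j)
∸1∸-+ˡ m {n} {j} j<n rewrite ∸-+-assoc (m + n) 1 j | ∸-+-assoc n 1 j = +-∸-assoc m j<n

∸1∸-+ʳ : ∀ m n j → (m + n) ∸ 1 ∸ (j + n) ≡ m ∸ 1 ∸ j
∸1∸-+ʳ m n j
  rewrite ∸-+-assoc (m + n) 1 (j + n) | ∸-+-assoc m 1 j | +-comm m n | +-comm j n | sym (+-suc n j)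
  = [m+n]∸[m+o]≡n∸o n m (suc j)

∸1∸-<ˡ : ∀ m {n j} → n ≤ j → j < m + n → (m + n) ∸ 1 ∸ j < m
∸1∸-<ˡ zero    n≤j j<n = ⊥-elim (<⇒≱ j<n n≤j)
∸1∸-<ˡ (suc m) {n} n≤j _ = s≤s (≤-trans (∸-monoʳ-≤ (m + n) n≤j) (≤-reflexive (m+n∸n≡m m n)))

bigPD-full : ∀ n r Ps {a c} → a < r fzero → c < rest n (λ i → r (fsuc i)) → bigPD (suc n) r Ps a c ≡ true
bigPD-full zero    r Ps _ ()
bigPD-full (suc n) r Ps {a} {c} a<r₀ c<X
  rewrite bigPD-unfold (suc (suc n)) r Ps a c | locate-first (suc (suc n)) r a<r₀
        | ∸1∸-+ˡ (r fzero) (<-≤-trans c<X (m≤n+m _ (r (fsuc fzero)))) | ∸1∸-+ˡ (r (fsuc fzero)) c<X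
        | locate-+ (suc n) r (r (fsuc fzero) + (sumSizes n (λ i → r (fsuc (fsuc i))) ∸ 1 ∸ c))
        | locate-+ n (λ i → r (fsuc i)) (sumSizes n (λ i → r (fsuc (fsuc i))) ∸ 1 ∸ c) = refl

concatMap-unzip : ∀ (A B : ℕ → List ℕ) t →
  (∀ a → All (t + a <_) (A a)) → (∀ a → All (_≤ t + a) (B a)) →
  ∀ m → concatMap (λ a → A a ++ B a) (upTo m) ≅ concatMap A (upTo m) ++ concatMap B (upTo m)
concatMap-unzip A B t A-above B-below zero    = ≅-refl
concatMap-unzip A B t A-above B-below (suc m) = begin
  concatMap AB (upTo (suc m))          ≡⟨ concatMap-upTo-suc AB m ⟩
  concatMap AB (upTo m) ++ (A m ++ B m) ≈⟨ ≅-++ (concatMap-unzip A B t A-above B-below m) ≅-refl ⟩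
  (As ++ Bs) ++ (A m ++ B m)           ≡⟨ ++-regroup As Bs (A m) (B m) ⟩
  As ++ (Bs ++ A m) ++ B m             ≈⟨ ≅-++ (≅-refl {As}) (≅-++ (++-commute-far Bs<t+m (A-above m)) ≅-refl) ⟩
  As ++ (A m ++ Bs) ++ B m             ≡⟨ ++-regroup As (A m) Bs (B m) ⟨
  (As ++ A m) ++ (Bs ++ B m)           ≡⟨ cong₂ _++_ (concatMap-upTo-suc A m) (concatMap-upTo-suc B m) ⟨
  concatMap A (upTo (suc m)) ++ concatMap B (upTo (suc m)) ∎
  where
  open SetoidReasoning ≅-setoid
  AB = λ a → A a ++ B a
  As = concatMap A (upTo m)
  Bs = concatMap B (upTo m)
  Bs<t+m : All (_< t + m) Bs
  Bs<t+m = concat⁺ (map⁺ (All.map (λ a<m → All.map (λ b≤t+a → ≤-<-trans b≤t+a (+-monoʳ-< t a<m)) (B-below _))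
                                     (upTo-< m)))

-- Block row 0 of Q = P(P₁, …, Pₙ₊₁) has height r₀ and consists of X = r₂ + ⋯ + rₙ₊₁
-- crossed columns, the piece P₁ = Ps fzero in the next r₁ columns, and r₀ empty
-- columns; the remaining rows and columns carry Q′ = P(P₂, …, Pₙ₊₁).
module Blocks (n : ℕ) (r : Fin (suc (suc n)) → ℕ) (Ps : Fin (suc n) → PipeDream) where
  r₀ = r fzero
  r₁ = r (fsuc fzero)
  r′ = λ i → r (fsuc i)
  Ps′ = λ i → Ps (fsuc i)
  d′ = sumSizes n r′
  X = rest n r′
  Q = bigPD (suc n) r Ps
  Q′ = bigPD n r′ Ps′

  Q-right-empty : ∀ a {c} → d′ ≤ c → c < r₀ + d′ → Q a c ≡ false
  Q-right-empty a {c} d′≤c c<d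
    rewrite bigPD-unfold (suc n) r Ps a c | locate-first (suc n) r (∸1∸-<ˡ r₀ d′≤c c<d) = refl

  Q-lower : ∀ a {c} → c < d′ → Q (r₀ + a) c ≡ Q′ a c
  Q-lower a {c} c<d′
    rewrite bigPD-unfold (suc n) r Ps (r₀ + a) c | bigPD-unfold n r′ Ps′ a c | ∸1∸-+ˡ r₀ c<d′
          | locate-+ n r a | locate-+ n r (d′ ∸ 1 ∸ c)
    = bigCross-suc n r Ps (proj₁ L) (proj₂ L) (proj₁ L′) (r′ (proj₁ L′) ∸ 1 ∸ proj₂ L′)
    where
    L  = locate n r′ a
    L′ = locate n r′ (d′ ∸ 1 ∸ c)

  Q-full : ∀ {a c} → a < r₀ → c < X → Q a c ≡ true
  Q-full = bigPD-full n r Ps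

  Q-diagonal : ∀ {a co} → a < r₀ → co < r₁ → Q a (co + X) ≡ Ps fzero a co
  Q-diagonal {a} {co} a<r₀ co<r₁
    rewrite bigPD-unfold (suc n) r Ps a (co + X) | locate-first (suc n) r a<r₀
          | sumSizes-rest n r′ | ∸1∸-+ˡ r₀ (+-monoˡ-< X co<r₁) | ∸1∸-+ʳ r₁ X co
          | locate-+ n r (r₁ ∸ 1 ∸ co) | locate-first n r′ (∸1∸-< co<r₁)
    = cong (Ps fzero a) (∸1∸-involutive co<r₁)

  Q-row : ∀ a → concatMap (cell Q a) (downFrom (r₀ + d′)) ≡ concatMap (cell Q a) (downFrom d′)
  Q-row a = begin
    concatMap (cell Q a) (downFrom (r₀ + d′))
      ≡⟨ cong (concatMap (cell Q a)) (downFrom-+ r₀ d′) ⟩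
    concatMap (cell Q a) (map (_+ d′) (downFrom r₀) ++ downFrom d′)
      ≡⟨ concatMap-++ (cell Q a) (map (_+ d′) (downFrom r₀)) (downFrom d′) ⟩
    concatMap (cell Q a) (map (_+ d′) (downFrom r₀)) ++ concatMap (cell Q a) (downFrom d′)
      ≡⟨ cong (_++ concatMap (cell Q a) (downFrom d′))
              (trans (concatMap-map (cell Q a) (_+ d′) (downFrom r₀)) right) ⟩
    concatMap (cell Q a) (downFrom d′) ∎
    where
    open ≡-Reasoning
    right : concatMap (λ x → cell Q a (x + d′)) (downFrom r₀) ≡ []
    right = concatMap-empty (All.map (λ {x} x<r₀ → cell-empty Q a (x + d′)
                                                     (Q-right-empty a (m≤n+m d′ x) (+-monoˡ-< d′ x<r₀)))
                                     (downFrom-< r₀))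

  Q-row-lower : ∀ a → concatMap (cell Q (r₀ + a)) (downFrom d′) ≡
                      map (r₀ +_) (concatMap (cell Q′ a) (downFrom d′))
  Q-row-lower a = trans (concatMap-cong-local (All.map cell-lower (downFrom-< d′)))
                        (sym (map-concatMap (r₀ +_) (cell Q′ a) (downFrom d′)))
    where
    cell-lower : ∀ {c} → c < d′ → cell Q (r₀ + a) c ≡ map (r₀ +_) (cell Q′ a c)
    cell-lower {c} c<d′ = cell-shift {P = Q} {P′ = Q′} r₀ (Q-lower a c<d′)
                                     (trans (cong suc (+-assoc r₀ a c)) (sym (+-suc r₀ (a + c))))

  diagonalRow : ℕ → List ℕ
  diagonalRow a = map (X +_) (concatMap (cell (Ps fzero) a) (downFrom r₁))

  fullRow : ℕ → List ℕ
  fullRow a = map (λ c → suc (a + c)) (downFrom X)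

  Q-row-upper : ∀ {a} → a < r₀ → concatMap (cell Q a) (downFrom d′) ≡ diagonalRow a ++ fullRow a
  Q-row-upper {a} a<r₀ = begin
    concatMap (cell Q a) (downFrom d′)
      ≡⟨ cong (concatMap (cell Q a) ∘′ downFrom) (sumSizes-rest n r′) ⟩
    concatMap (cell Q a) (downFrom (r₁ + X))
      ≡⟨ cong (concatMap (cell Q a)) (downFrom-+ r₁ X) ⟩
    concatMap (cell Q a) (map (_+ X) (downFrom r₁) ++ downFrom X)
      ≡⟨ concatMap-++ (cell Q a) (map (_+ X) (downFrom r₁)) (downFrom X) ⟩
    concatMap (cell Q a) (map (_+ X) (downFrom r₁)) ++ concatMap (cell Q a) (downFrom X)
      ≡⟨ cong₂ _++_ diagonal full ⟩
    diagonalRow a ++ fullRow a ∎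
    where
    open ≡-Reasoning
    letter : ∀ a co X → suc (a + (co + X)) ≡ X + suc (a + co)
    letter = solve-∀
    cell-diagonal : ∀ {co} → co < r₁ → cell Q a (co + X) ≡ map (X +_) (cell (Ps fzero) a co)
    cell-diagonal {co} co<r₁ = cell-shift {P = Q} {P′ = Ps fzero} X (Q-diagonal a<r₀ co<r₁) (letter a co X)
    diagonal : concatMap (cell Q a) (map (_+ X) (downFrom r₁)) ≡ diagonalRow a
    diagonal = begin
      concatMap (cell Q a) (map (_+ X) (downFrom r₁))
        ≡⟨ concatMap-map (cell Q a) (_+ X) (downFrom r₁) ⟩
      concatMap (λ co → cell Q a (co + X)) (downFrom r₁)
        ≡⟨ concatMap-cong-local (All.map cell-diagonal (downFrom-< r₁)) ⟩
      concatMap (λ co → map (X +_) (cell (Ps fzero) a co)) (downFrom r₁)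
        ≡⟨ map-concatMap (X +_) (cell (Ps fzero) a) (downFrom r₁) ⟨
      diagonalRow a ∎
    full : concatMap (cell Q a) (downFrom X) ≡ fullRow a
    full = begin
      concatMap (cell Q a) (downFrom X)
        ≡⟨ concatMap-cong-local (All.map (λ {c} c<X → cell-full Q a c (Q-full a<r₀ c<X)) (downFrom-< X)) ⟩
      concatMap (λ c → [ suc (a + c) ]) (downFrom X)
        ≡⟨ concatMap-map [_] (λ c → suc (a + c)) (downFrom X) ⟨
      concatMap [_] (fullRow a)
        ≡⟨ concatMap-pure (fullRow a) ⟩
      fullRow a ∎

  pdWord-Q : pdWord (r₀ + d′) (r₀ + d′) Q ≡
             concatMap (λ a → diagonalRow a ++ fullRow a) (upTo r₀) ++ map (r₀ +_) (pdWord d′ d′ Q′)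
  pdWord-Q = begin
    pdWord (r₀ + d′) (r₀ + d′) Q
      ≡⟨ pdWord-concatMap (r₀ + d′) (r₀ + d′) Q ⟩
    concatMap row (upTo (r₀ + d′))
      ≡⟨ cong (concatMap row) (upTo-+ r₀ d′) ⟩
    concatMap row (upTo r₀ ++ map (r₀ +_) (upTo d′))
      ≡⟨ concatMap-++ row (upTo r₀) (map (r₀ +_) (upTo d′)) ⟩
    concatMap row (upTo r₀) ++ concatMap row (map (r₀ +_) (upTo d′))
      ≡⟨ cong₂ _++_ upper lower ⟩
    concatMap (λ a → diagonalRow a ++ fullRow a) (upTo r₀) ++ map (r₀ +_) (pdWord d′ d′ Q′) ∎
    where
    open ≡-Reasoning
    row = λ a → concatMap (cell Q a) (downFrom (r₀ + d′))
    upper : concatMap row (upTo r₀) ≡ concatMap (λ a → diagonalRow a ++ fullRow a) (upTo r₀)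
    upper = concatMap-cong-local (All.map (λ {a} a<r₀ → trans (Q-row a) (Q-row-upper a<r₀)) (upTo-< r₀))
    lower : concatMap row (map (r₀ +_) (upTo d′)) ≡ map (r₀ +_) (pdWord d′ d′ Q′)
    lower = begin
      concatMap row (map (r₀ +_) (upTo d′))
        ≡⟨ concatMap-map row (r₀ +_) (upTo d′) ⟩
      concatMap (λ a → row (r₀ + a)) (upTo d′)
        ≡⟨ concatMap-cong (λ a → trans (Q-row (r₀ + a)) (Q-row-lower a)) (upTo d′) ⟩
      concatMap (λ a → map (r₀ +_) (concatMap (cell Q′ a) (downFrom d′))) (upTo d′)
        ≡⟨ map-concatMap (r₀ +_) _ (upTo d′) ⟨
      map (r₀ +_) (concatMap (λ a → concatMap (cell Q′ a) (downFrom d′)) (upTo d′))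
        ≡⟨ cong (map (r₀ +_)) (pdWord-concatMap d′ d′ Q′) ⟨
      map (r₀ +_) (pdWord d′ d′ Q′) ∎

  fullRows : List ℕ
  fullRows = concatMap fullRow (upTo r₀)

  pdWord-Q-≅ : pdWord (r₀ + d′) (r₀ + d′) Q ≅
               (map (X +_) (pdWord r₀ r₁ (Ps fzero)) ++ fullRows) ++ map (r₀ +_) (pdWord d′ d′ Q′)
  pdWord-Q-≅ = begin
    pdWord (r₀ + d′) (r₀ + d′) Q
      ≡⟨ pdWord-Q ⟩
    concatMap (λ a → diagonalRow a ++ fullRow a) (upTo r₀) ++ map (r₀ +_) (pdWord d′ d′ Q′)
      ≈⟨ ≅-++ (concatMap-unzip diagonalRow fullRow X diagonal-above full-below r₀) ≅-refl ⟩
    (concatMap diagonalRow (upTo r₀) ++ fullRows) ++ map (r₀ +_) (pdWord d′ d′ Q′)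
      ≡⟨ cong (λ w → (w ++ fullRows) ++ map (r₀ +_) (pdWord d′ d′ Q′)) diagonals ⟩
    (map (X +_) (pdWord r₀ r₁ (Ps fzero)) ++ fullRows) ++ map (r₀ +_) (pdWord d′ d′ Q′) ∎
    where
    open SetoidReasoning ≅-setoid
    diagonal-above : ∀ a → All (X + a <_) (diagonalRow a)
    diagonal-above a =
      map⁺ (concat⁺ (map⁺ (All.map (λ {co} _ → All.map (+-monoʳ-< X) (cell-above (Ps fzero) a co))
                                   (downFrom-< r₁))))
    full-below : ∀ a → All (_≤ X + a) (fullRow a)
    full-below a = map⁺ (All.map (λ {c} c<X → subst (_≤ X + a) (+-suc a c)
                                                (subst (a + suc c ≤_) (+-comm a X) (+-monoʳ-≤ a c<X)))
                                 (downFrom-< X))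
    diagonals : concatMap diagonalRow (upTo r₀) ≡ map (X +_) (pdWord r₀ r₁ (Ps fzero))
    diagonals = trans (sym (map-concatMap (X +_) _ (upTo r₀)))
                      (cong (map (X +_)) (sym (pdWord-concatMap r₀ r₁ (Ps fzero))))

bigPD-∼ : ∀ n r (Ps Ps′ : Fin n → PipeDream) →
  (∀ j → pdWord (r (inject₁ j)) (r (fsuc j)) (Ps j) ∼ pdWord (r (inject₁ j)) (r (fsuc j)) (Ps′ j)) →
  pdWord (sumSizes n r) (sumSizes n r) (bigPD n r Ps) ∼ pdWord (sumSizes n r) (sumSizes n r) (bigPD n r Ps′)
bigPD-∼ zero    r Ps Ps′ _       = mk∼ λ _ → refl  -- bigPD 0 r Ps has no crosses
bigPD-∼ (suc n) r Ps Ps′ pieces∼ = begin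
  pdWord dim dim B.Q
    ≈⟨ ≅⇒∼ B.pdWord-Q-≅ ⟩
  (map (X +_) (pdWord r₀ r₁ (Ps fzero)) ++ B.fullRows) ++ map (r₀ +_) (pdWord d′ d′ B.Q′)
    ≈⟨ ∼-++ (∼-congʳ first∼ B.fullRows) lower∼ ⟩
  (map (X +_) (pdWord r₀ r₁ (Ps′ fzero)) ++ B.fullRows) ++ map (r₀ +_) (pdWord d′ d′ B′.Q′)
    ≈⟨ ≅⇒∼ B′.pdWord-Q-≅ ⟨
  pdWord dim dim B′.Q ∎
  where
  open SetoidReasoning ∼-setoid
  module B  = Blocks n r Ps
  module B′ = Blocks n r Ps′
  open B using (r₀; r₁; d′; X)
  dim = sumSizes (suc n) r
  first∼ : map (X +_) (pdWord r₀ r₁ (Ps fzero)) ∼ map (X +_) (pdWord r₀ r₁ (Ps′ fzero))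
  first∼ = ∼-shift X (pdWord-positive r₀ r₁ _) (pdWord-positive r₀ r₁ _) (pieces∼ fzero)
  lower∼ : map (r₀ +_) (pdWord d′ d′ B.Q′) ∼ map (r₀ +_) (pdWord d′ d′ B′.Q′)
  lower∼ = ∼-shift r₀ (pdWord-positive d′ d′ _) (pdWord-positive d′ d′ _)
                   (bigPD-∼ n B.r′ B.Ps′ B′.Ps′ (λ j → pieces∼ (fsuc j)))

proposition3p3 : (n : ℕ) (r : Fin (suc n) → ℕ)
    (w : (j : Fin n) → PartialPerm (r (inject₁ j)) (r (fsuc j)))
    (P P′ : Fin n → PipeDream) →
    (∀ j → InPD (w j) (rot (r (inject₁ j)) (r (fsuc j)) (P j))) →
    (∀ j → InPD (w j) (rot (r (inject₁ j)) (r (fsuc j)) (P′ j))) →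
    ∀ p → δ (sumSizes n r) (sumSizes n r) (bigPD n r P) p
        ≡ δ (sumSizes n r) (sumSizes n r) (bigPD n r P′) p
proposition3p3 n r _ P P′ P∈ P′∈ = ∼⇒≗ (bigPD-∼ n r P P′ pieces∼)
  where
  pieces∼ : ∀ j → pdWord (r (inject₁ j)) (r (fsuc j)) (P j) ∼ pdWord (r (inject₁ j)) (r (fsuc j)) (P′ j)
  pieces∼ j = ∼-rot⁻ (r (inject₁ j)) (r (fsuc j)) (P j) (P′ j)
                      (mk∼ λ x → trans (P∈ j x) (sym (P′∈ j x)))
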